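{- Let $\{H_n\}_{n\ge1}$ be the positive linear recurrence sequence generated by coefficients $[c_1,\ldots,c_L]$ with $L\ge 1$ and all $c_i\ge 1$ (all coefficients strictly positive). Then $\{H_n\}$ is complete if and only if either $c_1=\cdots=c_L=1$, or $c_1=\cdots=c_{L-1}=1$ and $c_L=2$.
   Context: A positive linear recurrence sequence (PLRS) generated by coefficients $[c_1,\ldots,c_L]$ (with $L\ge1$, $c_i$ nonnegative integers, $c_1>0$, $c_L>0$) is the sequence $\{H_n\}_{n\ge1}$ defined by $H_1=1$; for $1\le n<L$, $H_{n+1}=c_1H_n+c_2H_{n-1}+\cdots+c_nH_1+1$; and for $n\ge L$, $H_{n+1}=c_1H_n+\cdots+c_LH_{n+1-L}$. A sequence of positive integers $\{f_i\}$ is complete if every positive integer is a sum of distinct terms of the sequence, i.e. $n=\sum_i\alpha_i f_i$ with $\alpha_i\in\{0,1\}$; otherwise it is incomplete. -}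

module Defs where

open import Data.Nat using (ℕ; zero; suc; _+_; _*_; _<_; _≤_; _<ᵇ_)
open import Data.Bool using (if_then_else_)
open import Data.List using (List; []; _∷_; length; map; zipWith)
open import Data.Nat.ListAction using (sum)
open import Data.Empty using (⊥)
open import Data.List.Relation.Unary.All using (All)
open import Data.List.Relation.Unary.Unique.Propositional using (Unique)
open import Data.Product using (∃; _×_)
open import Relation.Binary.PropositionalEquality using (_≡_)

-- Given coefficients cs = [c_1,...,c_L] and the reversed history
-- hs = [H_n, H_{n-1}, ..., H_1], the next term H_{n+1} is
--   c_1 H_n + ... + c_{min(n,L)} H_{n+1-min(n,L)}  (+ 1 if n < L).
nextTerm : List ℕ → List ℕ → ℕ
nextTerm cs hs = sum (zipWith _*_ cs hs) + (if length hs <ᵇ length cs then 1 else 0)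

history : List ℕ → ℕ → List ℕ
history cs zero    = []
history cs (suc n) = nextTerm cs (history cs n) ∷ history cs n

-- PLRS term H_n for n ≥ 1 (H 0 is a dummy value 0, never used).
H : List ℕ → ℕ → ℕ
H cs zero    = 0
H cs (suc n) = nextTerm cs (history cs n)

Complete : (ℕ → ℕ) → Set
Complete f = ∀ (m : ℕ) → 1 ≤ m →
  ∃ λ (ns : List ℕ) → Unique ns × All (λ i → 1 ≤ i) ns × sum (map f ns) ≡ m

AllOnes : List ℕ → Set
AllOnes cs = All (λ c → c ≡ 1) cs

OnesThenTwo : List ℕ → Set
OnesThenTwo []           = ⊥
OnesThenTwo (c ∷ [])     = c ≡ 2
OnesThenTwo (c ∷ d ∷ cs) = c ≡ 1 × OnesThenTwo (d ∷ cs)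

module Submission where

-- Brown's criterion: a sequence of positive integers in which each term is at most one more
-- than the sum of all earlier terms is complete, since the greedy choice of the largest
-- usable term always leaves a remainder that the earlier terms can represent. Conversely,
-- if a nondecreasing sequence has f(n+1) ≥ 2 + f(1) + … + f(n), then 1 + f(1) + … + f(n)
-- is not a sum of distinct terms. For coefficients 1,…,1 or 1,…,1,2 the recurrence preserves
-- Brown's bound: the extra copy of H_{n+1-L} contributed by the trailing 2 is absorbed by
-- Brown's bound at that earlier index. For every other list of positive coefficients, if the
-- first coefficient c ≠ 1 is c_{k+1}, then H_{k+2} = H_{k+1} + … + H_2 + c + [k+1 < L]
-- exceeds H_1 + … + H_{k+1} by at least 2.

open import Defs
open import Data.Nat
  using (ℕ; zero; suc; _+_; _*_; _≤_; _<_; _≤′_; ≤′-refl; ≤′-step; z≤n; s≤s; _<ᵇ_)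
open import Data.Nat.Properties
open import Data.Nat.ListAction.Properties using (sum-++)
open import Algebra.Properties.CommutativeSemigroup +-commutativeSemigroup using (x∙yz≈y∙xz)
open import Data.Bool using (true; false; if_then_else_)
open import Data.List using (List; []; _∷_; length; map; zipWith; replicate; filter; _++_; _∷ʳ_)
open import Data.List.Properties using (filter-all; filter-accept; filter-reject; zipWith-zeroʳ)
open import Data.Nat.ListAction using (sum)
open import Data.List.Relation.Unary.All as All using (All; []; _∷_; all?)
open import Data.List.Relation.Unary.All.Properties using (all-filter; ¬All⇒Any¬)
import Data.List.Relation.Unary.All.Properties as Allₚ
open import Data.List.Relation.Unary.AllPairs using ([]; _∷_)
open import Data.List.Relation.Unary.Unique.Propositional using (Unique)
import Data.List.Relation.Unary.Unique.Propositional.Properties as Uniqueₚ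
open import Data.List.Membership.Propositional using (_∈_; find)
open import Data.List.Membership.Propositional.Properties using (∈-map⁺)
open import Data.List.Relation.Unary.Any using (here; there)
open import Data.Product using (∃; _×_; _,_; proj₁)
open import Data.Sum using (_⊎_; inj₁; inj₂)
open import Data.Empty using (⊥-elim)
open import Data.Unit using (⊤; tt)
open import Relation.Nullary using (¬_; ¬?; yes; no)
open import Relation.Unary using (Decidable)
open import Relation.Binary.PropositionalEquality
open import Function.Bundles using (_⇔_; mk⇔)

sumTo : (ℕ → ℕ) → ℕ → ℕ
sumTo f zero    = 0
sumTo f (suc n) = f (suc n) + sumTo f n

BrownBounded : (ℕ → ℕ) → Set
BrownBounded f = ∀ k → f (suc k) ≤ suc (sumTo f k)

DistinctSumUpTo : (ℕ → ℕ) → ℕ → ℕ → Set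
DistinctSumUpTo f n m =
  ∃ λ ns → Unique ns × All (λ i → 1 ≤ i) ns × All (_≤ n) ns × sum (map f ns) ≡ m

∈⇒≤sum : ∀ {n ns} → n ∈ ns → n ≤ sum ns
∈⇒≤sum (here refl)  = m≤m+n _ _
∈⇒≤sum (there n∈ns) = ≤-trans (∈⇒≤sum n∈ns) (m≤n+m _ _)

≤-suc⇒monotone : ∀ {f : ℕ → ℕ} → (∀ n → f n ≤ f (suc n)) → ∀ {a b} → a ≤ b → f a ≤ f b
≤-suc⇒monotone {f} step a≤b = go (≤⇒≤′ a≤b)
  where
    go : ∀ {a b} → a ≤′ b → f a ≤ f b
    go ≤′-refl        = ≤-refl
    go (≤′-step a≤′b) = ≤-trans (go a≤′b) (step _)

DistinctSumUpTo-weaken : ∀ {f n m} → DistinctSumUpTo f n m → DistinctSumUpTo f (suc n) m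
DistinctSumUpTo-weaken (ns , u , pos , below , Σ≡) = ns , u , pos , All.map m≤n⇒m≤1+n below , Σ≡

DistinctSumUpTo-∷ : ∀ {f n m} → DistinctSumUpTo f n m → DistinctSumUpTo f (suc n) (f (suc n) + m)
DistinctSumUpTo-∷ {f} {n} (ns , u , pos , below , Σ≡) =
  suc n ∷ ns , All.map (λ i≤n eq → 1+n≰n (subst (_≤ n) (sym eq) i≤n)) below ∷ u ,
  s≤s z≤n ∷ pos , ≤-refl ∷ All.map m≤n⇒m≤1+n below , cong (f (suc n) +_) Σ≡

≤sumTo⇒DistinctSumUpTo : ∀ {f} → BrownBounded f →
                         ∀ n {m} → m ≤ sumTo f n → DistinctSumUpTo f n m
≤sumTo⇒DistinctSumUpTo bound zero    z≤n = [] , [] , [] , [] , refl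
≤sumTo⇒DistinctSumUpTo {f} bound (suc n) {m} m≤S with m ≤? sumTo f n
... | yes m≤S′ = DistinctSumUpTo-weaken (≤sumTo⇒DistinctSumUpTo bound n m≤S′)
... | no  m≰S′ = subst (DistinctSumUpTo f (suc n)) (m+[n∸m]≡n f≤m)
                   (DistinctSumUpTo-∷ (≤sumTo⇒DistinctSumUpTo bound n (m≤n+o⇒m∸n≤o m (f (suc n)) m≤S)))
  where
    f≤m : f (suc n) ≤ m
    f≤m = ≤-trans (bound n) (≰⇒> m≰S′)

sum-map-≤-+-filter≢ : ∀ f k {ns} → Unique ns →
  sum (map f ns) ≤ f k + sum (map f (filter (λ i → ¬? (i ≟ k)) ns))
sum-map-≤-+-filter≢ f k [] = z≤n
sum-map-≤-+-filter≢ f k {x ∷ xs} (x∉xs ∷ u) with x ≟ k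
... | yes refl = ≤-reflexive (cong (λ ys → f x + sum (map f ys)) (begin
      xs                        ≡⟨ filter-all ≢? (All.map (λ x≢i i≡x → x≢i (sym i≡x)) x∉xs) ⟨
      filter ≢? xs              ≡⟨ filter-reject ≢? (λ x≢x → x≢x refl) ⟨
      filter ≢? (x ∷ xs)        ∎))
  where
    open ≡-Reasoning
    ≢? : Decidable (_≢ x)
    ≢? i = ¬? (i ≟ x)
... | no x≢k   = begin
      f x + sum (map f xs)                     ≤⟨ +-monoʳ-≤ (f x) (sum-map-≤-+-filter≢ f k u) ⟩
      f x + (f k + sum (map f (filter ≢? xs))) ≡⟨ x∙yz≈y∙xz (f x) (f k) _ ⟩
      f k + sum (map f (x ∷ filter ≢? xs))     ≡⟨ cong (λ ys → f k + sum (map f ys)) (filter-accept ≢? x≢k) ⟨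
      f k + sum (map f (filter ≢? (x ∷ xs)))   ∎
  where
    open ≤-Reasoning
    ≢? : Decidable (_≢ k)
    ≢? i = ¬? (i ≟ k)

DistinctSumUpTo⇒≤sumTo : ∀ {f} n {m} → DistinctSumUpTo f n m → m ≤ sumTo f n
DistinctSumUpTo⇒≤sumTo zero (.[] , _ , [] , [] , refl) = z≤n
DistinctSumUpTo⇒≤sumTo zero (_ ∷ _ , _ , s≤s _ ∷ _ , () ∷ _ , _)
DistinctSumUpTo⇒≤sumTo {f} (suc n) (ns , u , pos , below , refl) =
  ≤-trans (sum-map-≤-+-filter≢ f (suc n) u)
    (+-monoʳ-≤ (f (suc n)) (DistinctSumUpTo⇒≤sumTo n
      (_ , Uniqueₚ.filter⁺ ≢? u , Allₚ.filter⁺ ≢? pos ,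
       All.zipWith (λ (i≤1+n , i≢1+n) → ≤-pred (≤∧≢⇒< i≤1+n i≢1+n))
         (Allₚ.filter⁺ ≢? below , all-filter ≢? ns) , refl)))
  where
    ≢? : Decidable (_≢ suc n)
    ≢? i = ¬? (i ≟ suc n)

n≤sumTo : ∀ {f} → (∀ k → 1 ≤ f (suc k)) → ∀ n → n ≤ sumTo f n
n≤sumTo pos zero    = z≤n
n≤sumTo pos (suc n) = +-mono-≤ (pos n) (n≤sumTo pos n)

BrownBounded⇒Complete : ∀ {f} → (∀ k → 1 ≤ f (suc k)) → BrownBounded f → Complete f
BrownBounded⇒Complete pos bound m _ =
  let ns , u , pos′ , _ , Σ≡ = ≤sumTo⇒DistinctSumUpTo bound m (n≤sumTo pos m) in ns , u , pos′ , Σ≡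

gap⇒¬Complete : ∀ {f} n → (∀ i → f i ≤ f (suc i)) → 2 + sumTo f n ≤ f (suc n) → ¬ Complete f
gap⇒¬Complete {f} n step gap complete with complete (suc (sumTo f n)) (s≤s z≤n)
... | ns , u , pos , Σ≡ with all? (_≤? n) ns
...   | yes below = 1+n≰n (DistinctSumUpTo⇒≤sumTo n (ns , u , pos , below , Σ≡))
...   | no ¬below with find (¬All⇒Any¬ (_≤? n) ns ¬below)
...     | i , i∈ns , i≰n = 1+n≰n (begin
  2 + sumTo f n       ≤⟨ gap ⟩
  f (suc n)           ≤⟨ ≤-suc⇒monotone step (≰⇒> i≰n) ⟩
  f i                 ≤⟨ ∈⇒≤sum (∈-map⁺ f i∈ns) ⟩
  sum (map f ns)      ≡⟨ Σ≡ ⟩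
  1 + sumTo f n       ∎)
  where open ≤-Reasoning

BrownBoundedList : List ℕ → Set
BrownBoundedList []       = ⊤
BrownBoundedList (h ∷ hs) = h ≤ suc (sum hs) × BrownBoundedList hs

Good : List ℕ → Set
Good cs = AllOnes cs ⊎ OnesThenTwo cs

sum-zipWith-ones-≤ : ∀ {cs} hs → AllOnes cs → sum (zipWith _*_ cs hs) ≤ sum hs
sum-zipWith-ones-≤ {cs} []       _          = ≤-reflexive (cong sum (zipWith-zeroʳ _*_ cs))
sum-zipWith-ones-≤ (h ∷ hs) []         = z≤n
sum-zipWith-ones-≤ (h ∷ hs) (refl ∷ p) = +-mono-≤ (≤-reflexive (*-identityˡ h)) (sum-zipWith-ones-≤ hs p)

sum-zipWith-onesThenTwo-≤ : ∀ {cs} hs → OnesThenTwo cs → BrownBoundedList hs →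
                            sum (zipWith _*_ cs hs) ≤ suc (sum hs)
sum-zipWith-onesThenTwo-≤ {_ ∷ _}     []       _          _             = z≤n
sum-zipWith-onesThenTwo-≤ {_ ∷ []}    (h ∷ hs) refl       (h≤ , _)      = begin
  2 * h + 0          ≡⟨ +-identityʳ (2 * h) ⟩
  2 * h              ≡⟨ cong (h +_) (+-identityʳ h) ⟩
  h + h              ≤⟨ +-monoʳ-≤ h h≤ ⟩
  h + suc (sum hs)   ≡⟨ +-suc h (sum hs) ⟩
  suc (h + sum hs)   ∎
  where open ≤-Reasoning
sum-zipWith-onesThenTwo-≤ {_ ∷ _ ∷ _} (h ∷ hs) (refl , p) (_ , bounded-hs) =
  ≤-trans (+-mono-≤ (≤-reflexive (*-identityˡ h)) (sum-zipWith-onesThenTwo-≤ hs p bounded-hs))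
          (≤-reflexive (+-suc h (sum hs)))

sum-zipWith-onesThenTwo-short : ∀ {cs} hs → OnesThenTwo cs → length hs < length cs →
                                sum (zipWith _*_ cs hs) ≤ sum hs
sum-zipWith-onesThenTwo-short {cs}        []       _          _          =
  ≤-reflexive (cong sum (zipWith-zeroʳ _*_ cs))
sum-zipWith-onesThenTwo-short {_ ∷ []}    (h ∷ hs) _          (s≤s ())
sum-zipWith-onesThenTwo-short {_ ∷ _ ∷ _} (h ∷ hs) (refl , p) (s≤s hs<cs) =
  +-mono-≤ (≤-reflexive (*-identityˡ h)) (sum-zipWith-onesThenTwo-short hs p hs<cs)

nextTerm-≤-suc-sum : ∀ cs hs → (length hs < length cs → sum (zipWith _*_ cs hs) ≤ sum hs) →
                     sum (zipWith _*_ cs hs) ≤ suc (sum hs) → nextTerm cs hs ≤ suc (sum hs)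
nextTerm-≤-suc-sum cs hs short long with length hs <ᵇ length cs | <ᵇ⇒< (length hs) (length cs)
... | true  | hs<cs = subst (_≤ suc (sum hs)) (+-comm 1 _) (s≤s (short (hs<cs tt)))
... | false | _     = subst (_≤ suc (sum hs)) (sym (+-identityʳ _)) long

Good⇒nextTerm-≤-suc-sum : ∀ {cs} hs → Good cs → BrownBoundedList hs → nextTerm cs hs ≤ suc (sum hs)
Good⇒nextTerm-≤-suc-sum {cs} hs (inj₁ ones) _ =
  nextTerm-≤-suc-sum cs hs (λ _ → sum-zipWith-ones-≤ hs ones) (m≤n⇒m≤1+n (sum-zipWith-ones-≤ hs ones))
Good⇒nextTerm-≤-suc-sum {cs} hs (inj₂ onesThenTwo) bounded-hs =
  nextTerm-≤-suc-sum cs hs (sum-zipWith-onesThenTwo-short hs onesThenTwo)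
    (sum-zipWith-onesThenTwo-≤ hs onesThenTwo bounded-hs)

history-BrownBoundedList : ∀ {cs} → Good cs → ∀ n → BrownBoundedList (history cs n)
history-BrownBoundedList good zero    = tt
history-BrownBoundedList good (suc n) =
  Good⇒nextTerm-≤-suc-sum _ good (history-BrownBoundedList good n) , history-BrownBoundedList good n

sumTo-H : ∀ cs n → sumTo (H cs) n ≡ sum (history cs n)
sumTo-H cs zero    = refl
sumTo-H cs (suc n) = cong (H cs (suc n) +_) (sumTo-H cs n)

H-BrownBounded : ∀ {cs} → Good cs → BrownBounded (H cs)
H-BrownBounded {cs} good k =
  subst (λ s → H cs (suc k) ≤ suc s) (sym (sumTo-H cs k)) (proj₁ (history-BrownBoundedList good (suc k)))

H-mono-step : ∀ {c ds} → 1 ≤ c → ∀ n → H (c ∷ ds) n ≤ H (c ∷ ds) (suc n)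
H-mono-step _                 zero    = z≤n
H-mono-step {suc c} {ds} (s≤s _) (suc n) =
  ≤-trans (m≤n*m h (suc c))
    (≤-trans (m≤m+n _ (sum (zipWith _*_ ds (history (suc c ∷ ds) n)))) (m≤m+n _ _))
  where
    h : ℕ
    h = H (suc c ∷ ds) (suc n)

H-positive : ∀ {c ds} → 1 ≤ c → ∀ n → 1 ≤ H (c ∷ ds) (suc n)
H-positive {c} {ds} c≥1 n = ≤-suc⇒monotone {H (c ∷ ds)} (H-mono-step c≥1) {1} {suc n} (s≤s z≤n)

data BadCoefficients : List ℕ → Set where
  early : ∀ k {c r} rs → 2 ≤ c → BadCoefficients (replicate k 1 ++ c ∷ r ∷ rs)
  last  : ∀ k {c}      → 3 ≤ c → BadCoefficients (replicate k 1 ++ c ∷ [])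

onesThenTwo-∷ : ∀ {cs} → OnesThenTwo cs → OnesThenTwo (1 ∷ cs)
onesThenTwo-∷ {_ ∷ _} p = refl , p

good⊎bad : ∀ cs → All (λ c → 1 ≤ c) cs → Good cs ⊎ BadCoefficients cs
good⊎bad []                       _         = inj₁ (inj₁ [])
good⊎bad (suc zero ∷ cs)          (_ ∷ pos) with good⊎bad cs pos
... | inj₁ (inj₁ ones)        = inj₁ (inj₁ (refl ∷ ones))
... | inj₁ (inj₂ onesThenTwo) = inj₁ (inj₂ (onesThenTwo-∷ onesThenTwo))
... | inj₂ (early k rs c≥2)   = inj₂ (early (suc k) rs c≥2)
... | inj₂ (last k c≥3)       = inj₂ (last (suc k) c≥3)
good⊎bad (suc (suc zero) ∷ [])    _         = inj₁ (inj₂ refl)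
good⊎bad (suc (suc c) ∷ r ∷ rs)   _         = inj₂ (early 0 rs (s≤s (s≤s z≤n)))
good⊎bad (suc (suc (suc c)) ∷ []) _         = inj₂ (last 0 (s≤s (s≤s (s≤s z≤n))))

history-∷ʳ : ∀ cs k → ∃ λ xs → length xs ≡ k × history cs (suc k) ≡ xs ∷ʳ H cs 1
history-∷ʳ cs zero    = [] , refl , refl
history-∷ʳ cs (suc k) with history-∷ʳ cs k
... | xs , refl , hist = H cs (suc (suc k)) ∷ xs , refl , cong (H cs (suc (suc k)) ∷_) hist

H-one : ∀ k {c} rest → H (replicate k 1 ++ c ∷ rest) 1 ≡ 1
H-one zero    rest = refl
H-one (suc k) rest = refl

sum-zipWith-onesPrefix : ∀ xs {c y} rest →
  sum (zipWith _*_ (replicate (length xs) 1 ++ c ∷ rest) (xs ∷ʳ y)) ≡ sum xs + c * y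
sum-zipWith-onesPrefix []       {c} {y} rest =
  trans (cong (λ zs → c * y + sum zs) (zipWith-zeroʳ _*_ rest)) (+-identityʳ _)
sum-zipWith-onesPrefix (x ∷ xs)         rest =
  trans (cong₂ _+_ (*-identityˡ x) (sum-zipWith-onesPrefix xs rest)) (sym (+-assoc x _ _))

<ᵇ-onesPrefix : ∀ (xs : List ℕ) {c y : ℕ} rest →
  (length (xs ∷ʳ y) <ᵇ length (replicate (length xs) 1 ++ c ∷ rest)) ≡ (0 <ᵇ length rest)
<ᵇ-onesPrefix []       rest = refl
<ᵇ-onesPrefix (x ∷ xs) rest = <ᵇ-onesPrefix xs rest

onesPrefix-gap : ∀ k c rest → 3 ≤ c + (if 0 <ᵇ length rest then 1 else 0) →
  let h = H (replicate k 1 ++ c ∷ rest) in 2 + sumTo h (suc k) ≤ h (2 + k)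
onesPrefix-gap k c rest 3≤c+b with history-∷ʳ (replicate k 1 ++ c ∷ rest) k
... | xs , refl , hist = begin
  2 + sumTo h (suc (length xs))  ≡⟨ cong (2 +_) (trans (sumTo-H cs _) (cong sum hist)) ⟩
  2 + sum (xs ∷ʳ h 1)            ≡⟨ cong (λ y → 2 + sum (xs ∷ʳ y)) (H-one (length xs) rest) ⟩
  2 + sum (xs ∷ʳ 1)              ≡⟨ cong (2 +_) (trans (sum-++ xs (1 ∷ [])) (+-comm (sum xs) 1)) ⟩
  3 + sum xs                     ≡⟨ +-comm 3 (sum xs) ⟩
  sum xs + 3                     ≤⟨ +-monoʳ-≤ (sum xs) 3≤c+b ⟩
  sum xs + (c + b)               ≡⟨ +-assoc (sum xs) c b ⟨
  sum xs + c + b                 ≡⟨ cong (λ y → sum xs + y + b) (*-identityʳ c) ⟨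
  sum xs + c * 1 + b             ≡⟨ cong (λ y → sum xs + c * y + b) (H-one (length xs) rest) ⟨
  sum xs + c * h 1 + b           ≡⟨ cong₂ _+_ (sum-zipWith-onesPrefix xs rest)
                                             (cong (λ t → if t then 1 else 0) (<ᵇ-onesPrefix xs rest)) ⟨
  nextTerm cs (xs ∷ʳ h 1)        ≡⟨ cong (nextTerm cs) hist ⟨
  h (2 + length xs)              ∎
  where
    open ≤-Reasoning
    cs : List ℕ
    cs = replicate (length xs) 1 ++ c ∷ rest
    h : ℕ → ℕ
    h = H cs
    b : ℕ
    b = if 0 <ᵇ length rest then 1 else 0

BadCoefficients⇒gap : ∀ {cs} → BadCoefficients cs → ∃ λ n → 2 + sumTo (H cs) n ≤ H cs (suc n)
BadCoefficients⇒gap (early k rs c≥2) = suc k , onesPrefix-gap k _ (_ ∷ rs) (+-monoˡ-≤ 1 c≥2)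
BadCoefficients⇒gap (last k c≥3)     = suc k , onesPrefix-gap k _ [] (≤-trans c≥3 (m≤m+n _ 0))

mainTheorem1 : (c₁ : ℕ) (cs : List ℕ) → All (λ c → 1 ≤ c) (c₁ ∷ cs) →
    Complete (H (c₁ ∷ cs)) ⇔ (AllOnes (c₁ ∷ cs) ⊎ OnesThenTwo (c₁ ∷ cs))
mainTheorem1 c₁ cs pos@(c₁≥1 ∷ _) = mk⇔ complete⇒good good⇒complete
  where
    good⇒complete : Good (c₁ ∷ cs) → Complete (H (c₁ ∷ cs))
    good⇒complete good = BrownBounded⇒Complete (H-positive c₁≥1) (H-BrownBounded good)

    complete⇒good : Complete (H (c₁ ∷ cs)) → Good (c₁ ∷ cs)
    complete⇒good complete with good⊎bad (c₁ ∷ cs) pos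
    ... | inj₁ good = good
    ... | inj₂ bad  = let n , gap = BadCoefficients⇒gap bad in
                      ⊥-elim (gap⇒¬Complete n (H-mono-step c₁≥1) gap complete)
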